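{- Let $K_n$ be the complete graph on $n\ge2$ vertices. Then $\gamma_t(M(K_n))= \left\lceil \frac{2n}{3} \right\rceil$.
   Context: All graphs are finite and simple. For a graph $H$ with no isolated vertices, a total dominating set of $H$ is a set $S\subseteq V(H)$ such that every vertex of $H$ has at least one neighbor in $S$; $\gamma_t(H)$ is the minimum cardinality of a total dominating set. The middle graph $M(G)$ of a graph $G$ has vertex set $V(G)\cup E(G)$ (disjoint union), and two of its vertices $x,y$ are adjacent exactly when either $x,y\in E(G)$ are edges of $G$ sharing a common endpoint, or $x\in V(G)$, $y\in E(G)$ and $x$ is an endpoint of $y$ (no two elements of $V(G)$ are adjacent in $M(G)$). -}

module Defs where

open import Data.Nat using (ℕ; _+_; _*_; _/_; _≤_)
open import Data.Fin using (Fin; _<_; _≟_)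
open import Data.Bool using (Bool; not; T)
open import Data.Product using (Σ; Σ-syntax; ∃-syntax; _×_; _,_)
open import Data.Sum using (_⊎_; inj₁; inj₂)
open import Data.Empty using (⊥)
open import Data.List using (List; length)
open import Data.List.Membership.Propositional using (_∈_)
open import Data.List.Relation.Unary.Unique.Propositional using (Unique)
open import Relation.Nullary using (¬_)
open import Relation.Nullary.Decidable using (⌊_⌋)
open import Relation.Binary.PropositionalEquality using (_≡_)

record Graph : Set₁ where
  field
    V   : Set
    Adj : V → V → Set

open Graph public

record SimpleGraph (n : ℕ) : Set where
  field
    adj     : Fin n → Fin n → Bool
    symm    : ∀ i j → adj i j ≡ adj j i
    irrefl  : ∀ i → adj i i ≡ Data.Bool.false

open SimpleGraph public

-- Edges of G: unordered pairs {i,j}, represented as i < j, with i ~ j.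
Edge : ∀ {n} → SimpleGraph n → Set
Edge {n} G = Σ[ i ∈ Fin n ] Σ[ j ∈ Fin n ] (i < j × T (adj G i j))

endpoint₁ : ∀ {n} {G : SimpleGraph n} → Edge G → Fin n
endpoint₁ (i , _ , _) = i

endpoint₂ : ∀ {n} {G : SimpleGraph n} → Edge G → Fin n
endpoint₂ (_ , j , _) = j

IsEndpoint : ∀ {n} {G : SimpleGraph n} → Fin n → Edge G → Set
IsEndpoint {G = G} v e = v ≡ endpoint₁ {G = G} e ⊎ v ≡ endpoint₂ {G = G} e

EdgesAdjacent : ∀ {n} {G : SimpleGraph n} → Edge G → Edge G → Set
EdgesAdjacent {G = G} e f =
  ¬ (endpoint₁ {G = G} e ≡ endpoint₁ {G = G} f × endpoint₂ {G = G} e ≡ endpoint₂ {G = G} f)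
  × (Σ[ v ∈ _ ] (IsEndpoint {G = G} v e × IsEndpoint {G = G} v f))

MiddleAdj : ∀ {n} (G : SimpleGraph n) → (Fin n ⊎ Edge G) → (Fin n ⊎ Edge G) → Set
MiddleAdj G (inj₁ _) (inj₁ _) = ⊥
MiddleAdj G (inj₁ v) (inj₂ e) = IsEndpoint {G = G} v e
MiddleAdj G (inj₂ e) (inj₁ v) = IsEndpoint {G = G} v e
MiddleAdj G (inj₂ e) (inj₂ f) = EdgesAdjacent {G = G} e f

Middle : ∀ {n} → SimpleGraph n → Graph
Middle {n} G = record { V = Fin n ⊎ Edge G ; Adj = MiddleAdj G }

complete : (n : ℕ) → SimpleGraph n
complete n = record
  { adj = λ i j → not ⌊ i ≟ j ⌋
  ; symm = symm'
  ; irrefl = irr }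
  where
  open import Relation.Binary.PropositionalEquality using (refl; sym)
  open import Relation.Nullary using (yes; no)
  symm' : ∀ i j → not ⌊ i ≟ j ⌋ ≡ not ⌊ j ≟ i ⌋
  symm' i j with i ≟ j | j ≟ i
  ... | yes _ | yes _ = refl
  ... | no _  | no _  = refl
  ... | yes p | no q  = Data.Empty.⊥-elim (q (sym p))
  ... | no p  | yes q = Data.Empty.⊥-elim (p (sym q))
  irr : ∀ i → not ⌊ i ≟ i ⌋ ≡ Data.Bool.false
  irr i with i ≟ i
  ... | yes _ = refl
  ... | no p  = Data.Empty.⊥-elim (p refl)

IsTotalDominating : (H : Graph) → List (V H) → Set
IsTotalDominating H S = ∀ (x : V H) → Σ[ y ∈ V H ] (y ∈ S × Adj H x y)

TotalDominationNumber : Graph → ℕ → Set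
TotalDominationNumber H k =
  (Σ[ S ∈ List (V H) ] (Unique S × IsTotalDominating H S × length S ≡ k))
  × (∀ (S : List (V H)) → Unique S → IsTotalDominating H S → k ≤ length S)

⌈_/3⌉ : ℕ → ℕ
⌈ m /3⌉ = (m + 2) / 3

-- In M(G) a vertex v of G is adjacent only to edges, so a total dominating set S contains
-- an edge p(v) at every vertex v. Give each vertex two tokens and each element of S three
-- places. The first token of v goes to the place of v in p(v). The second goes to the spare
-- place of p(v), except when v is the second endpoint of p(v) and the first endpoint also
-- chose p(v); then p(v) has a neighbour y in S, and the token goes to a place of y: any
-- place if y is a vertex, and if y is an edge meeting p(v) at w, the place of w in y, which
-- no first token uses since p(w) = p(v) ≠ y.
-- This assignment has a left inverse, so 2n ≤ 3|S|.
-- For Kₙ the bound is attained by cutting 0, …, n − 1 into consecutive blocks of three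
-- vertices and taking the two path edges of each block, except that one block is a path on
-- four vertices, or an edge {0, 1} together with the vertex 0, according to n mod 3.

module Submission where

open import Defs
open import Data.Nat as ℕ using (ℕ; zero; suc; _+_; _*_; _≤_; _<_; s≤s)
import Data.Nat.Properties as ℕ
open import Data.Nat.DivMod using (m<n*o⇒m/o<n; +-distrib-/-∣ˡ)
open import Data.Nat.Divisibility using (divides-refl)
open import Data.Fin as Fin using (Fin; zero; suc; toℕ; fromℕ<; _≟_; combine; remQuot)
import Data.Fin.Properties as Fin
open import Data.Bool using (if_then_else_)
open import Data.Bool.Properties using (T-irrelevant)
open import Data.Product using (Σ-syntax; ∃-syntax; _×_; _,_; proj₁; proj₂; uncurry)
open import Data.Sum as Sum using (_⊎_; inj₁; inj₂)
open import Data.Empty using (⊥-elim)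
open import Data.List using (List; []; _∷_; _++_; length; lookup; map)
open import Data.List.Properties using (length-++; length-map)
open import Data.List.Membership.Propositional using (_∈_)
open import Data.List.Membership.Propositional.Properties using (∈-++⁺ˡ; ∈-++⁺ʳ)
open import Data.List.Relation.Unary.Any using (here; there; index)
open import Data.List.Relation.Unary.Any.Properties using (lookup-index)
open import Data.List.Relation.Unary.All as All using (All; []; _∷_)
import Data.List.Relation.Unary.All.Properties as All
open import Data.List.Relation.Unary.AllPairs using ([]; _∷_)
open import Data.List.Relation.Unary.Unique.Propositional using (Unique)
import Data.List.Relation.Unary.Unique.Propositional.Properties as Unique
open import Function using (_∘_; _∘′_)
open import Relation.Binary.Definitions using (DecidableEquality)
open import Relation.Binary.PropositionalEquality
open import Relation.Nullary using (¬_; Dec; yes; no; does)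
open import Relation.Nullary.Decidable using (fromWitnessFalse; dec-true; dec-false)

retraction⇒*-≤ : ∀ {a b c d} (f : Fin a × Fin b → Fin c × Fin d)
                 (g : Fin c × Fin d → Fin a × Fin b) → (∀ x → g (f x) ≡ x) → a * b ≤ c * d
retraction⇒*-≤ {a} {b} {c} {d} f g g∘f≡id = Fin.injective⇒≤ {f = h} h-injective
  where
  h : Fin (a * b) → Fin (c * d)
  h i = uncurry combine (f (remQuot b i))
  h-injective : ∀ {i j} → h i ≡ h j → i ≡ j
  h-injective {i} {j} hi≡hj = begin
    i                                 ≡⟨ Fin.combine-remQuot {a} b i ⟨
    uncurry combine (remQuot {a} b i) ≡⟨ cong (uncurry combine) remQuot-i≡remQuot-j ⟩
    uncurry combine (remQuot {a} b j) ≡⟨ Fin.combine-remQuot {a} b j ⟩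
    j                                 ∎
    where
    open ≡-Reasoning
    remQuot-combine : ∀ p → remQuot {c} d (uncurry combine p) ≡ p
    remQuot-combine (x , y) = Fin.remQuot-combine x y
    remQuot-i≡remQuot-j : remQuot {a} b i ≡ remQuot b j
    remQuot-i≡remQuot-j = begin
      remQuot b i          ≡⟨ g∘f≡id _ ⟨
      g (f (remQuot b i))  ≡⟨ cong g (remQuot-combine _) ⟨
      g (remQuot d (h i))  ≡⟨ cong (g ∘′ remQuot d) hi≡hj ⟩
      g (remQuot d (h j))  ≡⟨ cong g (remQuot-combine _) ⟩
      g (f (remQuot b j))  ≡⟨ g∘f≡id _ ⟩
      remQuot b j          ∎

⌈/3⌉-least : ∀ m k → m ≤ 3 * k → ⌈ m /3⌉ ≤ k
⌈/3⌉-least m k m≤3k = ℕ.s≤s⁻¹ (m<n*o⇒m/o<n {m + 2} {suc k} {3} m+2<[1+k]*3)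
  where
  m+2<[1+k]*3 : m + 2 < suc k * 3
  m+2<[1+k]*3 = begin-strict
    m + 2      <⟨ ℕ.+-monoʳ-< m (ℕ.n<1+n 2) ⟩
    m + 3      ≤⟨ ℕ.+-monoˡ-≤ 3 m≤3k ⟩
    3 * k + 3  ≡⟨ cong (_+ 3) (ℕ.*-comm 3 k) ⟩
    k * 3 + 3  ≡⟨ ℕ.+-comm (k * 3) 3 ⟩
    suc k * 3  ∎
    where open ℕ.≤-Reasoning

NeighbourIn : (H : Graph) → List (V H) → V H → Set
NeighbourIn H S x = Σ[ y ∈ V H ] (y ∈ S × Adj H x y)

module _ {n : ℕ} (G : SimpleGraph n) where

  Edge-ext : {e f : Edge G} → endpoint₁ {G = G} e ≡ endpoint₁ {G = G} f →
             endpoint₂ {G = G} e ≡ endpoint₂ {G = G} f → e ≡ f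
  Edge-ext {i , j , i<j , ij} {.i , .j , i<j′ , ij′} refl refl =
    cong₂ (λ p q → i , j , p , q) (ℕ.<-irrelevant i<j i<j′) (T-irrelevant ij ij′)

  Edge-≟ : DecidableEquality (Edge G)
  Edge-≟ e f with endpoint₁ {G = G} e ≟ endpoint₁ {G = G} f
               | endpoint₂ {G = G} e ≟ endpoint₂ {G = G} f
  ... | yes p | yes q = yes (Edge-ext p q)
  ... | no ¬p | _     = no (¬p ∘ cong (endpoint₁ {G = G}))
  ... | _     | no ¬q = no (¬q ∘ cong (endpoint₂ {G = G}))

module Charging {n : ℕ} (G : SimpleGraph n) (S : List (Fin n ⊎ Edge G))
                (dom : IsTotalDominating (Middle G) S) where

  private
    end₁ end₂ : Edge G → Fin n
    end₁ = endpoint₁ {G = G}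
    end₂ = endpoint₂ {G = G}

    _∈ᴱ_ : Fin n → Edge G → Set
    v ∈ᴱ e = IsEndpoint {G = G} v e

    _≟ᴱ_ : DecidableEquality (Edge G)
    _≟ᴱ_ = Edge-≟ G

  other-endpoint : ∀ {v e} → v ∈ᴱ e → v ≢ end₁ e → v ≡ end₂ e
  other-endpoint (inj₁ v≡end₁) v≢end₁ = ⊥-elim (v≢end₁ v≡end₁)
  other-endpoint (inj₂ v≡end₂) _      = v≡end₂

  chosen : (v : Fin n) → Σ[ e ∈ Edge G ] (inj₂ e ∈ S × v ∈ᴱ e)
  chosen v with dom (inj₁ v)
  ... | inj₂ e , e∈S , v∈e = e , e∈S , v∈e

  choice : Fin n → Edge G
  choice v = proj₁ (chosen v)

  choice∈S : ∀ v → inj₂ (choice v) ∈ S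
  choice∈S v = proj₁ (proj₂ (chosen v))

  ∈choice : ∀ v → v ∈ᴱ choice v
  ∈choice v = proj₂ (proj₂ (chosen v))

  Token : Set
  Token = Fin n × Fin 2

  pattern first  = zero
  pattern second = suc zero

  -- Slots 0 and 1 of an edge stand for its two endpoints; slot 2 is a spare.
  Place : Set
  Place = (Σ[ x ∈ Fin n ⊎ Edge G ] x ∈ S) × Fin 3

  pattern slot₁ = zero
  pattern slot₂ = suc zero
  pattern spare = suc (suc zero)

  slotOf : Fin n → Edge G → Fin 3
  slotOf v e = if does (v ≟ end₁ e) then slot₁ else slot₂

  endAt : Edge G → Fin 3 → Fin n
  endAt e slot₁ = end₁ e
  endAt e _     = end₂ e

  Dominator : Edge G → Set
  Dominator e = NeighbourIn (Middle G) S (inj₂ e)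

  dominatorPlace : ∀ {e} → Dominator e → Place
  dominatorPlace (inj₁ u , u∈S , _)              = (inj₁ u , u∈S) , slot₁
  dominatorPlace (inj₂ f , f∈S , _ , w , _ , w∈f) = (inj₂ f , f∈S) , slotOf w f

  secondPlace : (v : Fin n) → Dec (v ≡ end₁ (choice v)) →
                Dec (choice (end₁ (choice v)) ≡ choice v) → Place
  secondPlace v (yes _) _       = (inj₂ (choice v) , choice∈S v) , spare
  secondPlace v (no _)  (no _)  = (inj₂ (choice v) , choice∈S v) , spare
  secondPlace v (no _)  (yes _) = dominatorPlace (dom (inj₂ (choice v)))

  charge : Token → Place
  charge (v , first)  = (inj₂ (choice v) , choice∈S v) , slotOf v (choice v)
  charge (v , second) = secondPlace v (v ≟ end₁ (choice v)) (choice (end₁ (choice v)) ≟ᴱ choice v)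

  viaEndpoint : Edge G → Fin n → Token
  viaEndpoint f w = if does (choice w ≟ᴱ f) then (w , first) else (end₂ (choice w) , second)

  viaSpare : Edge G → Token
  viaSpare f = if does (choice (end₁ f) ≟ᴱ f) then (end₁ f , second) else (end₂ f , second)

  decode : Fin n ⊎ Edge G → Fin 3 → Token
  decode (inj₁ u) _     = end₂ (choice u) , second
  decode (inj₂ f) spare = viaSpare f
  decode (inj₂ f) s     = viaEndpoint f (endAt f s)

  decodePlace : Place → Token
  decodePlace ((x , _) , s) = decode x s

  viaEndpoint-choice : ∀ w → viaEndpoint (choice w) w ≡ (w , first)
  viaEndpoint-choice w =
    cong (if_then (w , first) else (end₂ (choice w) , second)) (dec-true (choice w ≟ᴱ choice w) refl)

  viaEndpoint-¬choice : ∀ {f w} → choice w ≢ f → viaEndpoint f w ≡ (end₂ (choice w) , second)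
  viaEndpoint-¬choice {f} {w} w↛f =
    cong (if_then (w , first) else (end₂ (choice w) , second)) (dec-false (choice w ≟ᴱ f) w↛f)

  viaSpare-end₁ : ∀ {f} → choice (end₁ f) ≡ f → viaSpare f ≡ (end₁ f , second)
  viaSpare-end₁ {f} end₁→f = cong (if_then (end₁ f , second) else (end₂ f , second))
                                 (dec-true (choice (end₁ f) ≟ᴱ f) end₁→f)

  viaSpare-end₂ : ∀ {f} → choice (end₁ f) ≢ f → viaSpare f ≡ (end₂ f , second)
  viaSpare-end₂ {f} end₁↛f = cong (if_then (end₁ f , second) else (end₂ f , second))
                                 (dec-false (choice (end₁ f) ≟ᴱ f) end₁↛f)

  decode-slotOf : ∀ {w f} → w ∈ᴱ f → decode (inj₂ f) (slotOf w f) ≡ viaEndpoint f w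
  decode-slotOf {w} {f} w∈f with w ≟ end₁ f
  ... | yes w≡end₁ = cong (viaEndpoint f) (sym w≡end₁)
  ... | no w≢end₁  = cong (viaEndpoint f) (sym (other-endpoint {e = f} w∈f w≢end₁))

  decode-dominatorPlace : ∀ {e} → ((u : Fin n) → u ∈ᴱ e → choice u ≡ e) → (d : Dominator e) →
                          decodePlace (dominatorPlace d) ≡ (end₂ e , second)
  decode-dominatorPlace e-chosen (inj₁ u , _ , u∈e) =
    cong (λ f → end₂ f , second) (e-chosen u u∈e)
  decode-dominatorPlace {e} e-chosen (inj₂ f , _ , e≉f , w , w∈e , w∈f) = begin
    decode (inj₂ f) (slotOf w f)  ≡⟨ decode-slotOf w∈f ⟩
    viaEndpoint f w               ≡⟨ viaEndpoint-¬choice choice-w≢f ⟩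
    end₂ (choice w) , second      ≡⟨ cong (λ g → end₂ g , second) (e-chosen w w∈e) ⟩
    end₂ e , second               ∎
    where
    open ≡-Reasoning
    choice-w≢f : choice w ≢ f
    choice-w≢f choice-w≡f = e≉f (cong end₁ e≡f , cong end₂ e≡f)
      where e≡f = trans (sym (e-chosen w w∈e)) choice-w≡f

  decode-secondPlace : (v : Fin n) (d₁ : Dec (v ≡ end₁ (choice v)))
                       (d₂ : Dec (choice (end₁ (choice v)) ≡ choice v)) →
                       decodePlace (secondPlace v d₁ d₂) ≡ (v , second)
  decode-secondPlace v (yes v≡end₁) _ =
    trans (viaSpare-end₁ {choice v} (cong choice (sym v≡end₁))) (cong (_, second) (sym v≡end₁))
  decode-secondPlace v (no v≢end₁) (no end₁↛e) =
    trans (viaSpare-end₂ {choice v} end₁↛e)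
          (cong (_, second) (sym (other-endpoint {e = choice v} (∈choice v) v≢end₁)))
  decode-secondPlace v (no v≢end₁) (yes end₁→e) =
    trans (decode-dominatorPlace e-chosen (dom (inj₂ e))) (cong (_, second) (sym v≡end₂))
    where
    e = choice v
    v≡end₂ : v ≡ end₂ e
    v≡end₂ = other-endpoint {e = e} (∈choice v) v≢end₁
    e-chosen : (u : Fin n) → u ∈ᴱ e → choice u ≡ e
    e-chosen u (inj₁ u≡end₁) = trans (cong choice u≡end₁) end₁→e
    e-chosen u (inj₂ u≡end₂) = cong choice (trans u≡end₂ (sym v≡end₂))

  decode-charge : ∀ t → decodePlace (charge t) ≡ t
  decode-charge (v , first)  = trans (decode-slotOf (∈choice v)) (viaEndpoint-choice v)
  decode-charge (v , second) =
    decode-secondPlace v (v ≟ end₁ (choice v)) (choice (end₁ (choice v)) ≟ᴱ choice v)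

  2n≤3∣S∣ : 2 * n ≤ 3 * length S
  2n≤3∣S∣ = subst₂ _≤_ (ℕ.*-comm n 2) (ℕ.*-comm (length S) 3)
              (retraction⇒*-≤ encode decodeIndex decodeIndex-encode)
    where
    encode : Token → Fin (length S) × Fin 3
    encode t = index (proj₂ (proj₁ (charge t))) , proj₂ (charge t)
    decodeIndex : Fin (length S) × Fin 3 → Token
    decodeIndex (k , s) = decode (lookup S k) s
    decodeIndex-encode : ∀ t → decodeIndex (encode t) ≡ t
    decodeIndex-encode t with charge t | decode-charge t
    ... | (x , x∈S) , s | ≡t = trans (cong (λ y → decode y s) (sym (lookup-index x∈S))) ≡t

totalDominating-length-≥ : ∀ {n} (G : SimpleGraph n) (S : List (Fin n ⊎ Edge G)) →
                           IsTotalDominating (Middle G) S → ⌈ 2 * n /3⌉ ≤ length S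
totalDominating-length-≥ G S dom = ⌈/3⌉-least _ (length S) (Charging.2n≤3∣S∣ G S dom)

-- A vertex k of Kₙ, or the edge link k = {k, k + 1}.
data Piece : Set where
  vertex : ℕ → Piece
  link   : ℕ → Piece

InRange : ℕ → Piece → Set
InRange n (vertex k) = k < n
InRange n (link k)   = suc k < n

LinkDominated : List Piece → ℕ → Set
LinkDominated L c = (∃[ u ] vertex u ∈ L × (u ≡ c ⊎ u ≡ suc c))
                  ⊎ (∃[ k ] link k ∈ L × (suc k ≡ c ⊎ k ≡ suc c))

Covers : ℕ → List Piece → Set
Covers n L = ∀ v → v < n → ∃[ c ] link c ∈ L × (v ≡ c ⊎ v ≡ suc c) × LinkDominated L c

record PathCover (n : ℕ) (L : List Piece) : Set where
  field
    inRange : All (InRange n) L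
    unique  : Unique L
    covers  : Covers n L

pieces : ℕ → List Piece
pieces 0 = []
pieces 1 = []
pieces 2 = vertex 0 ∷ link 0 ∷ []
pieces 3 = link 0 ∷ link 1 ∷ []
pieces 4 = link 0 ∷ link 1 ∷ link 2 ∷ []
pieces (suc (suc (suc n@(suc (suc _))))) = pieces n ++ link n ∷ link (suc n) ∷ []

length-pieces : ∀ m → length (pieces (2 + m)) ≡ ⌈ 2 * (2 + m) /3⌉
length-pieces 0 = refl
length-pieces 1 = refl
length-pieces 2 = refl
length-pieces (suc (suc (suc m))) = begin
  length (pieces (2 + m) ++ _)   ≡⟨ length-++ (pieces (2 + m)) ⟩
  length (pieces (2 + m)) + 2    ≡⟨ cong (_+ 2) (length-pieces m) ⟩
  ⌈ 2 * (2 + m) /3⌉ + 2          ≡⟨ ⌈/3⌉-+6 (2 * (2 + m)) ⟨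
  ⌈ 6 + 2 * (2 + m) /3⌉          ≡⟨ cong ⌈_/3⌉ (ℕ.*-distribˡ-+ 2 3 (2 + m)) ⟨
  ⌈ 2 * (5 + m) /3⌉              ∎
  where
  open ≡-Reasoning
  ⌈/3⌉-+6 : ∀ k → ⌈ 6 + k /3⌉ ≡ ⌈ k /3⌉ + 2
  ⌈/3⌉-+6 k = trans (+-distrib-/-∣ˡ {6} (k + 2) {3} (divides-refl 2)) (ℕ.+-comm 2 _)

below-3+ : ∀ n v → n ≤ v → v < 3 + n → v ≡ n ⊎ v ≡ 1 + n ⊎ v ≡ 2 + n
below-3+ zero 0 _ _ = inj₁ refl
below-3+ zero 1 _ _ = inj₂ (inj₁ refl)
below-3+ zero 2 _ _ = inj₂ (inj₂ refl)
below-3+ zero (suc (suc (suc _))) _ (s≤s (s≤s (s≤s ())))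
below-3+ (suc n) (suc v) (s≤s n≤v) (s≤s v<3+n) =
  Sum.map (cong suc) (Sum.map (cong suc) (cong suc)) (below-3+ n v n≤v v<3+n)

LinkDominated-++⁺ˡ : ∀ {L c} R → LinkDominated L c → LinkDominated (L ++ R) c
LinkDominated-++⁺ˡ R (inj₁ (u , u∈L , u∈c)) = inj₁ (u , ∈-++⁺ˡ u∈L , u∈c)
LinkDominated-++⁺ˡ R (inj₂ (k , k∈L , k~c)) = inj₂ (k , ∈-++⁺ˡ k∈L , k~c)

pathCover-extend : ∀ {n L} → PathCover n L → PathCover (3 + n) (L ++ link n ∷ link (suc n) ∷ [])
pathCover-extend {n} {L} cover = record
  { inRange = All.++⁺ (All.map (widen _) inRange) (ℕ.n≤1+n _ ∷ ℕ.≤-refl ∷ [])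
  ; unique  = Unique.++⁺ unique (((λ ()) ∷ []) ∷ [] ∷ []) old∉new
  ; covers  = covers′ }
  where
  open PathCover cover
  new = link n ∷ link (suc n) ∷ []
  L′ = L ++ new

  widen : ∀ x → InRange n x → InRange (3 + n) x
  widen (vertex _) = ℕ.m≤n⇒m≤o+n 3
  widen (link _)   = ℕ.m≤n⇒m≤o+n 3

  old∉new : ∀ {x} → ¬ (x ∈ L × x ∈ new)
  old∉new (x∈L , here refl)         = ℕ.m+n≮n 1 n (All.lookup inRange x∈L)
  old∉new (x∈L , there (here refl)) = ℕ.m+n≮n 2 n (All.lookup inRange x∈L)

  link-n : link n ∈ L′
  link-n = ∈-++⁺ʳ L (here refl)
  link-1+n : link (suc n) ∈ L′
  link-1+n = ∈-++⁺ʳ L (there (here refl))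

  covers′ : Covers (3 + n) L′
  covers′ v v<3+n with v ℕ.<? n
  ... | yes v<n = let (c , c∈L , v∈c , dominated) = covers v v<n
                  in c , ∈-++⁺ˡ c∈L , v∈c , LinkDominated-++⁺ˡ new dominated
  ... | no v≮n with below-3+ n v (ℕ.≮⇒≥ v≮n) v<3+n
  ... | inj₁ v≡n          = n , link-n , inj₁ v≡n , inj₂ (suc n , link-1+n , inj₂ refl)
  ... | inj₂ (inj₁ v≡1+n) = n , link-n , inj₂ v≡1+n , inj₂ (suc n , link-1+n , inj₂ refl)
  ... | inj₂ (inj₂ v≡2+n) = suc n , link-1+n , inj₂ v≡2+n , inj₂ (n , link-n , inj₁ refl)

pathCover : ∀ m → PathCover (2 + m) (pieces (2 + m))
pathCover 0 = record
  { inRange = ℕ.<ᵇ⇒< 0 2 _ ∷ ℕ.<ᵇ⇒< 1 2 _ ∷ []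
  ; unique  = ((λ ()) ∷ []) ∷ [] ∷ []
  ; covers  = covers }
  where
  covers : Covers 2 (pieces 2)
  covers 0 _ = 0 , there (here refl) , inj₁ refl , inj₁ (0 , here refl , inj₁ refl)
  covers 1 _ = 0 , there (here refl) , inj₂ refl , inj₁ (0 , here refl , inj₁ refl)
  covers (suc (suc _)) (s≤s (s≤s ()))
pathCover 1 = record
  { inRange = ℕ.<ᵇ⇒< 1 3 _ ∷ ℕ.<ᵇ⇒< 2 3 _ ∷ []
  ; unique  = ((λ ()) ∷ []) ∷ [] ∷ []
  ; covers  = covers }
  where
  covers : Covers 3 (pieces 3)
  covers 0 _ = 0 , here refl , inj₁ refl , inj₂ (1 , there (here refl) , inj₂ refl)
  covers 1 _ = 0 , here refl , inj₂ refl , inj₂ (1 , there (here refl) , inj₂ refl)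
  covers 2 _ = 1 , there (here refl) , inj₂ refl , inj₂ (0 , here refl , inj₁ refl)
  covers (suc (suc (suc _))) (s≤s (s≤s (s≤s ())))
pathCover 2 = record
  { inRange = ℕ.<ᵇ⇒< 1 4 _ ∷ ℕ.<ᵇ⇒< 2 4 _ ∷ ℕ.<ᵇ⇒< 3 4 _ ∷ []
  ; unique  = ((λ ()) ∷ (λ ()) ∷ []) ∷ ((λ ()) ∷ []) ∷ [] ∷ []
  ; covers  = covers }
  where
  covers : Covers 4 (pieces 4)
  covers 0 _ = 0 , here refl , inj₁ refl , inj₂ (1 , there (here refl) , inj₂ refl)
  covers 1 _ = 0 , here refl , inj₂ refl , inj₂ (1 , there (here refl) , inj₂ refl)
  covers 2 _ = 1 , there (here refl) , inj₂ refl , inj₂ (0 , here refl , inj₁ refl)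
  covers 3 _ = 2 , there (there (here refl)) , inj₂ refl , inj₂ (1 , there (here refl) , inj₁ refl)
  covers (suc (suc (suc (suc _)))) (s≤s (s≤s (s≤s (s≤s ()))))
pathCover (suc (suc (suc m))) = pathCover-extend (pathCover m)

module Realise (n : ℕ) where

  private
    K = complete n

    end₁ end₂ : Edge K → Fin n
    end₁ = endpoint₁ {G = K}
    end₂ = endpoint₂ {G = K}

    _∈ᴱ_ : Fin n → Edge K → Set
    v ∈ᴱ e = IsEndpoint {G = K} v e

  linkEdge : (k : ℕ) → suc k < n → Edge K
  linkEdge k 1+k<n = i , j , i<j , fromWitnessFalse (Fin.<⇒≢ i<j)
    where
    k<n = ℕ.<-trans (ℕ.n<1+n k) 1+k<n
    i j : Fin n
    i = fromℕ< k<n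
    j = fromℕ< 1+k<n
    i<j : i Fin.< j
    i<j = subst₂ _<_ (sym (Fin.toℕ-fromℕ< k<n)) (sym (Fin.toℕ-fromℕ< 1+k<n)) (ℕ.n<1+n k)

  toℕ-end₁-linkEdge : ∀ k p → toℕ (end₁ (linkEdge k p)) ≡ k
  toℕ-end₁-linkEdge k p = Fin.toℕ-fromℕ< _

  toℕ-end₂-linkEdge : ∀ k p → toℕ (end₂ (linkEdge k p)) ≡ suc k
  toℕ-end₂-linkEdge k p = Fin.toℕ-fromℕ< p

  ∈linkEdge : ∀ {v k} p → toℕ v ≡ k ⊎ toℕ v ≡ suc k → v ∈ᴱ linkEdge k p
  ∈linkEdge {k = k} p =
    Sum.map (λ v≡k   → Fin.toℕ-injective (trans v≡k (sym (toℕ-end₁-linkEdge k p))))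
            (λ v≡1+k → Fin.toℕ-injective (trans v≡1+k (sym (toℕ-end₂-linkEdge k p))))

  realise : (x : Piece) → InRange n x → Fin n ⊎ Edge K
  realise (vertex k) k<n = inj₁ (fromℕ< k<n)
  realise (link k) 1+k<n = inj₂ (linkEdge k 1+k<n)

  code : Fin n ⊎ Edge K → Piece
  code (inj₁ v) = vertex (toℕ v)
  code (inj₂ e) = link (toℕ (end₁ e))

  code-realise : ∀ x p → code (realise x p) ≡ x
  code-realise (vertex k) p = cong vertex (Fin.toℕ-fromℕ< p)
  code-realise (link k)   p = cong link (toℕ-end₁-linkEdge k p)

  realiseAll : ∀ {L} → All (InRange n) L → List (Fin n ⊎ Edge K)
  realiseAll = All.reduce (λ {x} → realise x)

  map-code-realiseAll : ∀ {L} (ps : All (InRange n) L) → map code (realiseAll ps) ≡ L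
  map-code-realiseAll []       = refl
  map-code-realiseAll (p ∷ ps) = cong₂ _∷_ (code-realise _ p) (map-code-realiseAll ps)

  ∈-realiseAll : ∀ {x L} (ps : All (InRange n) L) (x∈L : x ∈ L) →
                 realise x (All.lookup ps x∈L) ∈ realiseAll ps
  ∈-realiseAll (p ∷ ps) (here refl) = here refl
  ∈-realiseAll (p ∷ ps) (there x∈L) = there (∈-realiseAll ps x∈L)

  consecutive⇒≢ : ∀ {k c} → suc k ≡ c ⊎ k ≡ suc c → c ≢ k
  consecutive⇒≢ (inj₁ 1+k≡c) c≡k = ℕ.1+n≢n (trans 1+k≡c c≡k)
  consecutive⇒≢ (inj₂ k≡1+c) c≡k = ℕ.1+n≢n (sym (trans c≡k k≡1+c))

  linkDominated⇒neighbour : ∀ {L c} (ps : All (InRange n) L) → LinkDominated L c → (p : suc c < n) →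
                            NeighbourIn (Middle K) (realiseAll ps) (inj₂ (linkEdge c p))
  linkDominated⇒neighbour ps (inj₁ (u , u∈L , u∈c)) p =
    realise (vertex u) q , ∈-realiseAll ps u∈L ,
    ∈linkEdge p (Sum.map (trans (Fin.toℕ-fromℕ< q)) (trans (Fin.toℕ-fromℕ< q)) u∈c)
    where q = All.lookup ps u∈L
  linkDominated⇒neighbour {c = c} ps (inj₂ (k , k∈L , k~c)) p =
    realise (link k) q , ∈-realiseAll ps k∈L , distinct k~c , shared k~c
    where
    q = All.lookup ps k∈L
    e f : Edge K
    e = linkEdge c p
    f = linkEdge k q
    distinct : suc k ≡ c ⊎ k ≡ suc c → ¬ (end₁ e ≡ end₁ f × end₂ e ≡ end₂ f)
    distinct k~c (end₁≡ , _) = consecutive⇒≢ k~c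
      (trans (sym (toℕ-end₁-linkEdge c p)) (trans (cong toℕ end₁≡) (toℕ-end₁-linkEdge k q)))
    shared : suc k ≡ c ⊎ k ≡ suc c → Σ[ w ∈ Fin n ] (w ∈ᴱ e × w ∈ᴱ f)
    shared (inj₁ 1+k≡c) =
      end₁ e , inj₁ refl , ∈linkEdge q (inj₂ (trans (toℕ-end₁-linkEdge c p) (sym 1+k≡c)))
    shared (inj₂ k≡1+c) =
      end₂ e , inj₂ refl , ∈linkEdge q (inj₁ (trans (toℕ-end₂-linkEdge c p) (sym k≡1+c)))

  realiseAll-totalDominating : ∀ {L} (ps : All (InRange n) L) → Covers n L →
                               IsTotalDominating (Middle K) (realiseAll ps)
  realiseAll-totalDominating ps covers (inj₁ v) with covers (toℕ v) (Fin.toℕ<n v)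
  ... | c , c∈L , v∈c , _ = realise (link c) p , ∈-realiseAll ps c∈L , ∈linkEdge p v∈c
    where p = All.lookup ps c∈L
  realiseAll-totalDominating ps covers (inj₂ e) with covers (toℕ (end₁ e)) (Fin.toℕ<n (end₁ e))
  ... | c , c∈L , end₁∈c , dominated with Edge-≟ K e (linkEdge c (All.lookup ps c∈L))
  ... | yes e≡link = subst (λ e → NeighbourIn (Middle K) (realiseAll ps) (inj₂ e)) (sym e≡link)
                       (linkDominated⇒neighbour ps dominated (All.lookup ps c∈L))
  ... | no e≢link = realise (link c) p , ∈-realiseAll ps c∈L ,
                    (e≢link ∘ uncurry (Edge-ext K)) , end₁ e , inj₁ refl , ∈linkEdge p end₁∈c
    where p = All.lookup ps c∈L

  pathCover⇒totalDominatingSet : ∀ {L} → PathCover n L →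
    Σ[ S ∈ List (Fin n ⊎ Edge K) ] (Unique S × IsTotalDominating (Middle K) S × length S ≡ length L)
  pathCover⇒totalDominatingSet {L} cover =
    realiseAll inRange ,
    Unique.map⁻ (subst Unique (sym (map-code-realiseAll inRange)) unique) ,
    realiseAll-totalDominating inRange covers ,
    trans (sym (length-map code (realiseAll inRange))) (cong length (map-code-realiseAll inRange))
    where open PathCover cover

proposition2p8 : ∀ (n : ℕ) → 2 ≤ n → TotalDominationNumber (Middle (complete n)) ⌈ 2 * n /3⌉
proposition2p8 1 (s≤s ())
proposition2p8 (suc (suc m)) _ =
  (let S , unique , dominating , ∣S∣≡ = Realise.pathCover⇒totalDominatingSet (2 + m) (pathCover m)
   in S , unique , dominating , trans ∣S∣≡ (length-pieces m)) ,
  λ S _ → totalDominating-length-≥ (complete (2 + m)) S
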